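{- For any integers $p\ge4$ and $q\ge3$, $\mathrm{def}_c(H_{p,q})=\mathrm{def}(H_{p,q})=pq-p-2q-2$.
   Context: All graphs are finite, simple and undirected. The Hertz graph $H_{p,q}$ ($p,q\ge2$) has vertex set $\{a,b_1,\dots,b_p,d\}\cup\{c^{(i)}_j:1\le i\le p,\ 1\le j\le q\}$ and edge set $\{ab_i:1\le i\le p\}\cup\{b_ic^{(i)}_j:1\le i\le p,1\le j\le q\}\cup\{c^{(i)}_jd:1\le i\le p,1\le j\le q\}$. An interval coloring is a proper edge coloring with positive integers such that the colors at every vertex form an interval of integers. A set $A\subseteq\{1,\dots,t\}$ is a cyclic interval modulo $t$ if $A$ or $\{1,\dots,t\}\setminus A$ is an interval of integers; a cyclic interval $t$-coloring is a proper edge coloring with colors $1,\dots,t$ in which the set of colors at every vertex is a cyclic interval modulo $t$. The deficiency $\mathrm{def}(G)$ (resp. cyclic deficiency $\mathrm{def}_c(G)$) is the minimum number of pendant edges whose attachment to $G$ yields a graph admitting an interval coloring (resp. a cyclic interval coloring). -}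

module Defs where

open import Data.Nat using (ℕ; _≤_; _<_)
open import Data.Fin using (Fin)
open import Data.Product using (Σ; ∃; _×_; _,_; proj₁; proj₂)
open import Data.Sum using (_⊎_; inj₁; inj₂)
open import Relation.Nullary using (¬_)
open import Relation.Binary.PropositionalEquality using (_≡_; _≢_)

record Graph : Set₁ where
  field
    V    : Set
    E    : Set
    ends : E → V × V
open Graph public

Incident : (G : Graph) → E G → V G → Set
Incident G e v = proj₁ (ends G e) ≡ v ⊎ proj₂ (ends G e) ≡ v

attach : (G : Graph) (k : ℕ) → (Fin k → V G) → Graph
attach G k att = record
  { V = V G ⊎ Fin k
  ; E = E G ⊎ Fin k
  ; ends = λ { (inj₁ e) → inj₁ (proj₁ (ends G e)) , inj₁ (proj₂ (ends G e))
             ; (inj₂ i) → inj₁ (att i) , inj₂ i } }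

-- Hertz graph H_{p,q}; indices 1..p, 1..q are represented by Fin p, Fin q.
data HV (p q : ℕ) : Set where
  a d : HV p q
  b   : Fin p → HV p q
  c   : Fin p → Fin q → HV p q

data HE (p q : ℕ) : Set where
  ab : Fin p → HE p q
  bc : Fin p → Fin q → HE p q
  cd : Fin p → Fin q → HE p q

Hertz : ℕ → ℕ → Graph
Hertz p q = record
  { V = HV p q
  ; E = HE p q
  ; ends = λ { (ab i)   → a , b i
             ; (bc i j) → b i , c i j
             ; (cd i j) → c i j , d } }

Proper : (G : Graph) → (E G → ℕ) → Set
Proper G col = ∀ e e' v → e ≢ e' → Incident G e v → Incident G e' v → col e ≢ col e'

ColorsAt : (G : Graph) → (E G → ℕ) → V G → ℕ → Set
ColorsAt G col v x = ∃ λ e → Incident G e v × col e ≡ x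

IsInterval : (ℕ → Set) → Set
IsInterval S = ∀ x y z → S x → S y → x ≤ z → z ≤ y → S z

IsCyclicInterval : ℕ → (ℕ → Set) → Set
IsCyclicInterval t A = IsInterval A ⊎ IsInterval (λ x → 1 ≤ x × x ≤ t × ¬ A x)

IntervalColoring : (G : Graph) → (E G → ℕ) → Set
IntervalColoring G col =
  (∀ e → 1 ≤ col e) × Proper G col × (∀ v → IsInterval (ColorsAt G col v))

CyclicIntervalColoring : (G : Graph) → ℕ → (E G → ℕ) → Set
CyclicIntervalColoring G t col =
  (∀ e → 1 ≤ col e × col e ≤ t) × Proper G col
  × (∀ v → IsCyclicInterval t (ColorsAt G col v))

HasIntervalColoring : Graph → Set
HasIntervalColoring G = ∃ λ col → IntervalColoring G col

HasCyclicIntervalColoring : Graph → Set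
HasCyclicIntervalColoring G = ∃ λ t → ∃ λ col → CyclicIntervalColoring G t col

IsMinPendant : (Graph → Set) → Graph → ℕ → Set
IsMinPendant P G dd =
  (∃ λ (att : Fin dd → V G) → P (attach G dd att))
  × (∀ k → k < dd → (att : Fin k → V G) → ¬ P (attach G k att))

IsDeficiency : Graph → ℕ → Set
IsDeficiency = IsMinPendant HasIntervalColoring

IsCyclicDeficiency : Graph → ℕ → Set
IsCyclicDeficiency = IsMinPendant HasCyclicIntervalColoring

-- Take a cyclic interval t-colouring (for an interval colouring, t = 0) of H_{p,q}
-- with k pendant edges. At each vertex v ≠ d the colours can be lifted to integers congruent
-- mod t such that two lifted colours at v differ by less than deg v. Summing lifted differences
-- along a b_i c_ij gives, for each of the pq paths, an integer congruent to the colour of c_ij d;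
-- these integers are pairwise distinct, and two of them differ by at most p + 2q + 1 + k, as two
-- paths meet at most five vertices besides d and the pendant edges at these are distinct.
-- Hence pq ≤ p + 2q + 2 + k.
-- Upper bound (i, j counted from 0). Colour c_ij d with qi + j + 2, the edges b_i c_ij by a
-- block of q consecutive colours next to these, and a b_i next to the block at b_i. The colours
-- of the a b_i are then distinct and lie in a window of p + (pq − p − 2q − 2) colours; the
-- missing ones go to pendant edges at a.

module Submission where

open import Defs
open import Data.Bool using (Bool; true; false; T; not; _∨_)
open import Data.Bool.Properties using (T-∨)
open import Data.Empty using (⊥; ⊥-elim)
open import Data.List using (List; []; _∷_; map)
open import Data.Nat.ListAction using (sum)
open import Data.List.Relation.Unary.All using (All; []; _∷_)
open import Data.List.Relation.Unary.AllPairs using ([]; _∷_)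
open import Data.List.Relation.Unary.Unique.Propositional using (Unique)
open import Data.Fin using (Fin; zero; suc; toℕ; fromℕ<; join; splitAt; remQuot; combine)
import Data.Fin.Properties as Fin
open import Data.Integer using (ℤ; +_; -_; ∣_∣; 0ℤ; 1ℤ)
  renaming (_+_ to _+ᶻ_; _-_ to _-ᶻ_; _*_ to _*ᶻ_)
import Data.Integer.Properties as ℤₚ
open import Data.Integer.DivMod using (_/ℕ_; a≡a%ℕn+[a/ℕn]*n; n%ℕd<d)
open import Data.Integer.Tactic.RingSolver using (solve-∀)
import Data.Nat.Tactic.RingSolver as ℕ-Solver
open import Data.Nat using (ℕ; zero; suc; _+_; _*_; _∸_; _≤_; _<_; _≟_; _≤?_; _<?_; z≤n; s≤s; s≤s⁻¹; z<s)
open import Data.Nat.Properties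
open import Data.Product using (Σ; ∃; _×_; _,_; proj₁; proj₂)
open import Data.Sum using (_⊎_; inj₁; inj₂)
import Data.Sum.Properties as Sum
open import Data.Unit using (tt)
open import Function using (_∘_; Equivalence)
open import Function.Definitions using (Injective)
open import Relation.Binary.PropositionalEquality
open import Relation.Nullary using (¬_; Dec; yes; no)
open import Relation.Nullary.Decidable using (⌊_⌋; ¬?; _×-dec_; _⊎-dec_; map′; fromWitness; toWitness)
open import Relation.Binary.Definitions using (DecidableEquality; tri<; tri≈; tri>)

count : ∀ {k} → (Fin k → Bool) → ℕ
count {zero}  f = 0
count {suc k} f with f zero
... | true  = suc (count (f ∘ suc))
... | false = count (f ∘ suc)

count+count-not : ∀ {k} (f : Fin k → Bool) → count f + count (not ∘ f) ≡ k
count+count-not {zero}  f = refl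
count+count-not {suc k} f with f zero
... | true  = cong suc (count+count-not (f ∘ suc))
... | false = trans (+-suc _ _) (cong suc (count+count-not (f ∘ suc)))

count≤ : ∀ {k} (f : Fin k → Bool) → count f ≤ k
count≤ f = subst (count f ≤_) (count+count-not f) (m≤m+n _ _)

count-∨ : ∀ {k} (f g : Fin k → Bool) → (∀ r → T (f r) → T (g r) → ⊥) →
          count (λ r → f r ∨ g r) ≡ count f + count g
count-∨ {zero}  f g disj = refl
count-∨ {suc k} f g disj with f zero | g zero | disj zero
... | true  | true  | both = ⊥-elim (both tt tt)
... | true  | false | _ = cong suc (count-∨ (f ∘ suc) (g ∘ suc) (disj ∘ suc))
... | false | true  | _ = trans (cong suc (count-∨ (f ∘ suc) (g ∘ suc) (disj ∘ suc))) (sym (+-suc _ _))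
... | false | false | _ = count-∨ (f ∘ suc) (g ∘ suc) (disj ∘ suc)

rank : ∀ {k} (f : Fin k → Bool) (r : Fin k) → T (f r) → Fin (count f)
rank {suc k} f zero    fr with f zero
... | true = zero
rank {suc k} f (suc r) fr with f zero
... | true  = suc (rank (f ∘ suc) r fr)
... | false = rank (f ∘ suc) r fr

select : ∀ {k} (f : Fin k → Bool) → Fin (count f) → Fin k
select {suc k} f j with f zero
select {suc k} f zero    | true = zero
select {suc k} f (suc j) | true = suc (select (f ∘ suc) j)
select {suc k} f j       | false = suc (select (f ∘ suc) j)

select-sound : ∀ {k} (f : Fin k → Bool) (j : Fin (count f)) → T (f (select f j))
select-sound {suc k} f j with f zero in eq
select-sound {suc k} f zero    | true = subst T (sym eq) tt
select-sound {suc k} f (suc j) | true = select-sound (f ∘ suc) j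
select-sound {suc k} f j       | false = select-sound (f ∘ suc) j

select-rank : ∀ {k} (f : Fin k → Bool) (r : Fin k) (fr : T (f r)) → select f (rank f r fr) ≡ r
select-rank {suc k} f zero    fr with f zero
... | true = refl
select-rank {suc k} f (suc r) fr with f zero
... | true  = cong suc (select-rank (f ∘ suc) r fr)
... | false = cong suc (select-rank (f ∘ suc) r fr)

select-injective : ∀ {k} (f : Fin k → Bool) (j j' : Fin (count f)) → select f j ≡ select f j' → j ≡ j'
select-injective {suc k} f j j' eq with f zero
select-injective {suc k} f zero    zero     eq | true = refl
select-injective {suc k} f (suc j) (suc j') eq | true =
  cong suc (select-injective (f ∘ suc) j j' (Fin.suc-injective eq))
select-injective {suc k} f j       j'       eq | false =
  select-injective (f ∘ suc) j j' (Fin.suc-injective eq)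

rank-injective : ∀ {k} (f : Fin k → Bool) (r r' : Fin k) (fr : T (f r)) (fr' : T (f r')) →
                 rank f r fr ≡ rank f r' fr' → r ≡ r'
rank-injective f r r' fr fr' eq =
  trans (sym (select-rank f r fr)) (trans (cong (select f) eq) (select-rank f r' fr'))

infix 4 _≡_mod_
record _≡_mod_ (x y : ℤ) (t : ℕ) : Set where
  constructor ≡mod
  field
    quotient : ℤ
    equation : x ≡ y +ᶻ quotient *ᶻ + t

≡mod-refl : ∀ {t} x → x ≡ x mod t
≡mod-refl {t} x = ≡mod 0ℤ (lemma x (+ t))
  where lemma : ∀ x t → x ≡ x +ᶻ 0ℤ *ᶻ t
        lemma = solve-∀

≡mod-sym : ∀ {t x y} → x ≡ y mod t → y ≡ x mod t
≡mod-sym {t} {_} {y} (≡mod M refl) = ≡mod (- M) (lemma y M (+ t))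
  where lemma : ∀ y M t → y ≡ y +ᶻ M *ᶻ t +ᶻ - M *ᶻ t
        lemma = solve-∀

≡mod-trans : ∀ {t x y z} → x ≡ y mod t → y ≡ z mod t → x ≡ z mod t
≡mod-trans {t} {z = z} (≡mod M refl) (≡mod M' refl) = ≡mod (M' +ᶻ M) (lemma z M M' (+ t))
  where lemma : ∀ z M M' t → z +ᶻ M' *ᶻ t +ᶻ M *ᶻ t ≡ z +ᶻ (M' +ᶻ M) *ᶻ t
        lemma = solve-∀

≡mod-+ : ∀ {t x x' y y'} → x ≡ x' mod t → y ≡ y' mod t → x +ᶻ y ≡ x' +ᶻ y' mod t
≡mod-+ {t} {x' = x'} {y' = y'} (≡mod M refl) (≡mod M' refl) = ≡mod (M +ᶻ M') (lemma x' y' M M' (+ t))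
  where lemma : ∀ x' y' M M' t → x' +ᶻ M *ᶻ t +ᶻ (y' +ᶻ M' *ᶻ t) ≡ x' +ᶻ y' +ᶻ (M +ᶻ M') *ᶻ t
        lemma = solve-∀

≡mod-- : ∀ {t x x' y y'} → x ≡ x' mod t → y ≡ y' mod t → x -ᶻ y ≡ x' -ᶻ y' mod t
≡mod-- {t} {x' = x'} {y' = y'} (≡mod M refl) (≡mod M' refl) = ≡mod (M -ᶻ M') (lemma x' y' M M' (+ t))
  where lemma : ∀ x' y' M M' t → x' +ᶻ M *ᶻ t -ᶻ (y' +ᶻ M' *ᶻ t) ≡ x' -ᶻ y' +ᶻ (M -ᶻ M') *ᶻ t
        lemma = solve-∀

≡mod0⇒≡ : ∀ {x y} → x ≡ y mod 0 → x ≡ y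
≡mod0⇒≡ {y = y} (≡mod M refl) = trans (cong (y +ᶻ_) (ℤₚ.*-zeroʳ M)) (ℤₚ.+-identityʳ y)

∣x-y∣-of-≡mod : ∀ {t x y} M → x ≡ y +ᶻ M *ᶻ + t → ∣ x -ᶻ y ∣ ≡ ∣ M ∣ * t
∣x-y∣-of-≡mod {t} {y = y} M refl = trans (cong ∣_∣ (lemma y M (+ t))) (ℤₚ.abs-* M (+ t))
  where lemma : ∀ y M t → y +ᶻ M *ᶻ t -ᶻ y ≡ M *ᶻ t
        lemma = solve-∀

≡mod-close⇒≡ : ∀ {t x y} → x ≡ y mod t → ∣ x -ᶻ y ∣ < t → x ≡ y
≡mod-close⇒≡ {t} {x} {y} (≡mod M eq) close =
  ℤₚ.i-j≡0⇒i≡j x y (ℤₚ.∣i∣≡0⇒i≡0 (trans ∣x-y∣≡ (small-multiple ∣ M ∣ (subst (_< t) ∣x-y∣≡ close))))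
  where
    ∣x-y∣≡ : ∣ x -ᶻ y ∣ ≡ ∣ M ∣ * t
    ∣x-y∣≡ = ∣x-y∣-of-≡mod M eq
    small-multiple : ∀ n → n * t < t → n * t ≡ 0
    small-multiple zero    _  = refl
    small-multiple (suc n) lt = ⊥-elim (<⇒≱ lt (m≤m+n t (n * t)))

∣+m-+n∣≡n∸m : ∀ {m n} → m ≤ n → ∣ + m -ᶻ + n ∣ ≡ n ∸ m
∣+m-+n∣≡n∸m {m} {n} m≤n = trans (cong ∣_∣ (ℤₚ.[+m]-[+n]≡m⊖n m n)) (ℤₚ.∣⊖∣-≤ m≤n)

∣+m-+n∣<t : ∀ {t m n} → 1 ≤ m → m ≤ t → 1 ≤ n → n ≤ t → ∣ + m -ᶻ + n ∣ < t
∣+m-+n∣<t {zero}  1≤m m≤0 _ _ = ⊥-elim (<⇒≱ 1≤m m≤0)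
∣+m-+n∣<t {suc t} {m} {n} 1≤m m≤t 1≤n n≤t with ≤-total m n
... | inj₁ m≤n = subst (_< suc t) (sym (∣+m-+n∣≡n∸m m≤n)) (s≤s (∸-mono n≤t 1≤m))
... | inj₂ n≤m = subst (_< suc t) (trans (sym (∣+m-+n∣≡n∸m n≤m)) (ℤₚ.∣i-j∣≡∣j-i∣ (+ n) (+ m))) (s≤s (∸-mono m≤t 1≤n))

close-injective⇒≤ : ∀ {m} L (h : Fin m → ℤ) → Injective _≡_ _≡_ h →
                    (∀ i j → ∣ h i -ᶻ h j ∣ ≤ L) → m ≤ suc L
close-injective⇒≤ {m} L h h-inj close = Fin.injective⇒≤ residue-injective
  where
  residue : Fin m → Fin (suc L)
  residue i = fromℕ< (n%ℕd<d (h i) (suc L))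
  ≡residue : ∀ i → h i ≡ + toℕ (residue i) mod suc L
  ≡residue i = ≡mod (h i /ℕ suc L) (trans (a≡a%ℕn+[a/ℕn]*n (h i) (suc L))
                                      (cong (λ r → + r +ᶻ h i /ℕ suc L *ᶻ + suc L) (sym (Fin.toℕ-fromℕ< _))))
  residue-injective : Injective _≡_ _≡_ residue
  residue-injective {i} {j} eq = h-inj (≡mod-close⇒≡
    (≡mod-trans (≡residue i) (subst (λ r → + toℕ r ≡ h j mod suc L) (sym eq) (≡mod-sym (≡residue j))))
    (s≤s (close i j)))

∣+∣-accumulate : ∀ i j {s m n} → ∣ i ∣ + s ≤ m → suc ∣ j ∣ ≤ n → ∣ i +ᶻ j ∣ + suc s ≤ m + n
∣+∣-accumulate i j {s} {m} {n} hi hj =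
  ≤-trans (+-monoˡ-≤ (suc s) (ℤₚ.∣i+j∣≤∣i∣+∣j∣ i j)) (subst (_≤ m + n) (rearrange _ _ s) (+-mono-≤ hi hj))
  where
  rearrange : ∀ x y s → x + s + suc y ≡ x + y + suc s
  rearrange = ℕ-Solver.solve-∀

Spans : (ℕ → Set) → ℕ → ℕ → Set
Spans A x y = Σ ℕ λ m → Σ (Fin m → ℕ) λ h →
  Injective _≡_ _≡_ h × (∀ j → A (h j)) × suc ∣ + x -ᶻ + y ∣ ≤ m

Spans-sym : ∀ {A} x y → Spans A x y → Spans A y x
Spans-sym x y (m , h , inj , mem , size) =
  m , h , inj , mem , subst (λ n → suc n ≤ m) (ℤₚ.∣i-j∣≡∣j-i∣ (+ x) (+ y)) size

spans-of-range : ∀ {A} (g : ℕ → ℕ) {lo hi} → lo ≤ hi →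
  (∀ w → lo ≤ w → w ≤ hi → A (g w)) →
  (∀ {w w'} → lo ≤ w → w ≤ hi → lo ≤ w' → w' ≤ hi → g w ≡ g w' → w ≡ w') →
  Spans A lo hi
spans-of-range {A} g {lo} {hi} lo≤hi mem inj = suc (hi ∸ lo) , h , h-inj , h-mem , size
  where
    h : Fin (suc (hi ∸ lo)) → ℕ
    h j = g (lo + toℕ j)
    in-range : ∀ (j : Fin (suc (hi ∸ lo))) → lo + toℕ j ≤ hi
    in-range j = subst (lo + toℕ j ≤_) (m+[n∸m]≡n lo≤hi) (+-monoʳ-≤ lo (s≤s⁻¹ (Fin.toℕ<n j)))
    h-inj : Injective _≡_ _≡_ h
    h-inj {i} {j} eq = Fin.toℕ-injective (+-cancelˡ-≡ lo _ _
      (inj (m≤m+n lo _) (in-range i) (m≤m+n lo _) (in-range j) eq))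
    h-mem : ∀ j → A (h j)
    h-mem j = mem _ (m≤m+n lo _) (in-range j)
    size : suc ∣ + lo -ᶻ + hi ∣ ≤ suc (hi ∸ lo)
    size = ≤-reflexive (cong suc (∣+m-+n∣≡n∸m lo≤hi))

spans-wlog : ∀ {A} (u : ℕ → ℕ) →
  (∀ {x y} → A x → A y → u x ≤ u y → Spans A (u x) (u y)) →
  ∀ {x y} → A x → A y → Spans A (u x) (u y)
spans-wlog {A} u ordered {x} {y} ax ay with ≤-total (u x) (u y)
... | inj₁ ux≤uy = ordered ax ay ux≤uy
... | inj₂ uy≤ux = Spans-sym {A} (u y) (u x) (ordered ay ax uy≤ux)

record Unwrapping (A : ℕ → Set) (t : ℕ) : Set where
  field
    unwrap       : ℕ → ℕ
    unwrap-≡mod  : ∀ {x} → A x → + unwrap x ≡ + x mod t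
    unwrap-spans : ∀ {x y} → A x → A y → Spans A (unwrap x) (unwrap y)

interval-unwrapping : ∀ {A} t → IsInterval A → Unwrapping A t
interval-unwrapping {A} t interval = record
  { unwrap       = λ x → x
  ; unwrap-≡mod  = λ {x} _ → ≡mod-refl (+ x)
  ; unwrap-spans = spans-wlog {A} (λ x → x) λ {x} {y} ax ay x≤y →
      spans-of-range {A} (λ w → w) x≤y (λ w x≤w w≤y → interval x y w ax ay x≤w w≤y) (λ _ _ _ _ eq → eq)
  }

-- Cutting the cycle at a missing colour z: adding t to the colours below z turns A into an
-- ordinary interval inside (z, z + t).
module Rotation {A : ℕ → Set} {t : ℕ} (A? : ∀ x → Dec (A x))
  (A⊆[1,t] : ∀ {x} → A x → 1 ≤ x × x ≤ t)
  (gaps-interval : IsInterval (λ x → 1 ≤ x × x ≤ t × ¬ A x))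
  {z : ℕ} (1≤z : 1 ≤ z) (z≤t : z ≤ t) (z∉A : ¬ A z) where

  rotate : ℕ → ℕ
  rotate x with x <? z
  ... | yes _ = x + t
  ... | no  _ = x

  unrotate : ℕ → ℕ
  unrotate w with w ≤? t
  ... | yes _ = w
  ... | no  _ = w ∸ t

  unrotate-≤ : ∀ {w} → w ≤ t → unrotate w ≡ w
  unrotate-≤ {w} w≤t with w ≤? t
  ... | yes _  = refl
  ... | no w≰t = ⊥-elim (w≰t w≤t)

  unrotate-≰ : ∀ {w} → ¬ w ≤ t → unrotate w ≡ w ∸ t
  unrotate-≰ {w} w≰t with w ≤? t
  ... | yes w≤t = ⊥-elim (w≰t w≤t)
  ... | no  _   = refl

  z<-of-A : ∀ {x} → A x → ¬ x < z → z < x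
  z<-of-A {x} ax x≮z = ≤∧≢⇒< (≮⇒≥ x≮z) λ { refl → z∉A ax }

  rotate-range : ∀ {x} → A x → z < rotate x × rotate x < z + t
  rotate-range {x} ax with x <? z
  ... | yes x<z = <-≤-trans (s≤s z≤t) (+-monoˡ-≤ t (proj₁ (A⊆[1,t] ax)))
                , +-monoˡ-< t x<z
  ... | no  x≮z = z<-of-A ax x≮z , <-≤-trans (s≤s (proj₂ (A⊆[1,t] ax))) (+-monoˡ-≤ t 1≤z)

  rotate-≡mod : ∀ x → + rotate x ≡ + x mod t
  rotate-≡mod x with x <? z
  ... | yes _ = ≡mod 1ℤ (trans (ℤₚ.pos-+ x t) (cong (+ x +ᶻ_) (sym (ℤₚ.*-identityˡ (+ t)))))
  ... | no  _ = ≡mod-refl (+ x)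

  wrapped-below-z : ∀ {u u'} → u ≤ t → ¬ u' ≤ t → u' < z + t → unrotate u ≡ unrotate u' → u < z
  wrapped-below-z {u} {u'} u≤t u'≰t u'<z+t eq =
    subst₂ _<_ (trans (sym (unrotate-≰ u'≰t)) (trans (sym eq) (unrotate-≤ u≤t))) (m+n∸n≡m z t)
      (∸-monoˡ-< u'<z+t (<⇒≤ (≰⇒> u'≰t)))

  unrotate-injective : ∀ {w w'} → z < w → w < z + t → z < w' → w' < z + t →
                       unrotate w ≡ unrotate w' → w ≡ w'
  unrotate-injective {w} {w'} z<w w<z+t z<w' w'<z+t eq = by-cases (w ≤? t) (w' ≤? t)
    where
    by-cases : Dec (w ≤ t) → Dec (w' ≤ t) → w ≡ w'
    by-cases (yes w≤t) (yes w'≤t) = trans (sym (unrotate-≤ w≤t)) (trans eq (unrotate-≤ w'≤t))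
    by-cases (no  w≰t) (no  w'≰t) = ∸-cancelʳ-≡ (<⇒≤ (≰⇒> w≰t)) (<⇒≤ (≰⇒> w'≰t))
                                      (trans (sym (unrotate-≰ w≰t)) (trans eq (unrotate-≰ w'≰t)))
    by-cases (yes w≤t) (no  w'≰t) = ⊥-elim (<-asym z<w (wrapped-below-z w≤t w'≰t w'<z+t eq))
    by-cases (no  w≰t) (yes w'≤t) = ⊥-elim (<-asym z<w' (wrapped-below-z w'≤t w≰t w<z+t (sym eq)))

  Gap : ℕ → Set
  Gap x = 1 ≤ x × x ≤ t × ¬ A x

  z-gap : Gap z
  z-gap = 1≤z , z≤t , z∉A

  ¬gap-below : ∀ {x w} → A x → rotate x ≤ w → w ≤ t → A w
  ¬gap-below {x} {w} ax x≤w w≤t with A? w | x <? z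
  ... | yes aw | _       = aw
  ... | no ¬aw | yes x<z = ⊥-elim (<⇒≱ (≤-<-trans w≤t (+-monoˡ-≤ t (proj₁ (A⊆[1,t] ax))))
                                       x≤w)
  ... | no ¬aw | no  x≮z = ⊥-elim (proj₂ (proj₂ (gaps-interval z w x z-gap gap-w (<⇒≤ (z<-of-A ax x≮z)) x≤w)) ax)
    where
    gap-w : Gap w
    gap-w = ≤-trans (proj₁ (A⊆[1,t] ax)) x≤w , w≤t , ¬aw

  ¬gap-above : ∀ {y w} → A y → t < w → w ≤ rotate y → A (w ∸ t)
  ¬gap-above {y} {w} ay t<w w≤y with A? (w ∸ t) | y <? z
  ... | yes aw | _       = aw
  ... | no ¬aw | yes y<z = ⊥-elim (proj₂ (proj₂ (gaps-interval (w ∸ t) z y gap-w z-gap w∸t≤y (<⇒≤ y<z))) ay)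
    where
    w∸t≤y : w ∸ t ≤ y
    w∸t≤y = subst (w ∸ t ≤_) (m+n∸n≡m y t) (∸-monoˡ-≤ t w≤y)
    gap-w : Gap (w ∸ t)
    gap-w = m<n⇒0<n∸m t<w , ≤-trans w∸t≤y (≤-trans (<⇒≤ y<z) z≤t) , ¬aw
  ... | no ¬aw | no  y≮z = ⊥-elim (<⇒≱ t<w (≤-trans w≤y (proj₂ (A⊆[1,t] ay))))

  unrotate-mem : ∀ {x y w} → A x → A y → rotate x ≤ w → w ≤ rotate y → A (unrotate w)
  unrotate-mem {x} {y} {w} ax ay x≤w w≤y with w ≤? t
  ... | yes w≤t = ¬gap-below ax x≤w w≤t
  ... | no  w≰t = ¬gap-above ay (≰⇒> w≰t) w≤y

  rotation : Unwrapping A t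
  rotation = record
    { unwrap       = rotate
    ; unwrap-≡mod  = λ {x} _ → rotate-≡mod x
    ; unwrap-spans = spans-wlog {A} rotate λ ax ay x≤y →
        spans-of-range {A} unrotate x≤y (λ _ → unrotate-mem ax ay)
          λ x≤w w≤y x≤w' w'≤y → unrotate-injective
            (<-≤-trans (proj₁ (rotate-range ax)) x≤w) (≤-<-trans w≤y (proj₂ (rotate-range ay)))
            (<-≤-trans (proj₁ (rotate-range ax)) x≤w') (≤-<-trans w'≤y (proj₂ (rotate-range ay)))
    }

cyclic-unwrapping : ∀ {A} t → (∀ x → Dec (A x)) → (∀ {x} → A x → 1 ≤ x × x ≤ t) →
                    IsCyclicInterval t A → Unwrapping A t
cyclic-unwrapping t A? A⊆[1,t] (inj₁ interval) = interval-unwrapping t interval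
cyclic-unwrapping {A} t A? A⊆[1,t] (inj₂ gaps-interval)
  with Fin.any? (λ (z : Fin (suc t)) → (1 ≤? toℕ z) ×-dec ¬? (A? (toℕ z)))
... | yes (z , 1≤z , z∉A) = Rotation.rotation A? A⊆[1,t] gaps-interval 1≤z (s≤s⁻¹ (Fin.toℕ<n z)) z∉A
... | no no-gap = interval-unwrapping t interval
  where
  interval : IsInterval A
  interval x y w ax ay x≤w w≤y with A? w
  ... | yes aw = aw
  ... | no ¬aw = ⊥-elim (no-gap (fromℕ< (s≤s w≤t) , subst (1 ≤_) (sym toℕ-w) (≤-trans (proj₁ (A⊆[1,t] ax)) x≤w)
                                                   , subst (¬_ ∘ A) (sym toℕ-w) ¬aw))
    where
    w≤t : w ≤ t
    w≤t = ≤-trans w≤y (proj₂ (A⊆[1,t] ay))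
    toℕ-w : toℕ (fromℕ< (s≤s w≤t)) ≡ w
    toℕ-w = Fin.toℕ-fromℕ< (s≤s w≤t)

interval-of-range : ∀ {S : ℕ → Set} l h → (∀ {z} → S z → l ≤ z × z ≤ h) →
                    (∀ {z} → l ≤ z → z ≤ h → S z) → IsInterval S
interval-of-range l h sound complete x y z sx sy x≤z z≤y =
  complete (≤-trans (proj₁ (sound sx)) x≤z) (≤-trans z≤y (proj₂ (sound sy)))

Adjacent-to-block : ℕ → ℕ → ℕ → Set
Adjacent-to-block x s n = x ≡ s + n ⊎ s ≡ suc x

adjacent∉block : ∀ {x s n} → Adjacent-to-block x s n → ∀ {j} → j < n → x ≢ s + j
adjacent∉block (inj₁ refl) {j} j<n eq = <-irrefl (+-cancelˡ-≡ _ _ _ (sym eq)) j<n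
adjacent∉block (inj₂ refl) {j} _   eq = <-irrefl eq (s≤s (m≤m+n _ j))

offset-in : ∀ {s z n} → s ≤ z → z < s + n → ∃ λ (j : Fin n) → s + toℕ j ≡ z
offset-in {s} {z} {n} s≤z z<s+n =
  fromℕ< z∸s<n , trans (cong (_+_ s) (Fin.toℕ-fromℕ< z∸s<n)) (m+[n∸m]≡n s≤z)
  where
  z∸s<n : z ∸ s < n
  z∸s<n = subst (z ∸ s <_) (m+n∸m≡n s n) (∸-monoˡ-< z<s+n s≤z)

block-with-neighbour-interval : ∀ {S : ℕ → Set} {x s n} → Adjacent-to-block x s n →
  S x → (∀ (j : Fin n) → S (s + toℕ j)) → (∀ {z} → S z → z ≡ x ⊎ ∃ λ (j : Fin n) → z ≡ s + toℕ j) →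
  IsInterval S
block-with-neighbour-interval {S} {x} {s} {n} (inj₁ refl) sx block only =
  interval-of-range s (s + n) sound complete
  where
  sound : ∀ {z} → S z → s ≤ z × z ≤ s + n
  sound sz with only sz
  ... | inj₁ refl       = m≤m+n s n , ≤-refl
  ... | inj₂ (j , refl) = m≤m+n s _ , +-monoʳ-≤ s (<⇒≤ (Fin.toℕ<n j))
  complete : ∀ {z} → s ≤ z → z ≤ s + n → S z
  complete {z} s≤z z≤s+n with z ≟ s + n
  ... | yes refl = sx
  ... | no  z≢   = subst S (proj₂ (offset-in s≤z (≤∧≢⇒< z≤s+n z≢))) (block _)
block-with-neighbour-interval {S} {x} {s} {n} (inj₂ refl) sx block only =
  interval-of-range x (x + n) sound complete
  where
  sound : ∀ {z} → S z → x ≤ z × z ≤ x + n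
  sound sz with only sz
  ... | inj₁ refl       = ≤-refl , m≤m+n x n
  ... | inj₂ (j , refl) = ≤-trans (n≤1+n x) (m≤m+n _ _) , subst (_≤ x + n) (+-suc x (toℕ j)) (+-monoʳ-≤ x (Fin.toℕ<n j))
  complete : ∀ {z} → x ≤ z → z ≤ x + n → S z
  complete {z} x≤z z≤x+n with x ≟ z
  ... | yes refl = sx
  ... | no  x≢z  = subst S (proj₂ (offset-in (≤∧≢⇒< x≤z x≢z) (s≤s z≤x+n))) (block _)

module Complement {p N : ℕ} (lo : ℕ) (f : Fin p → ℕ) (f-injective : Injective _≡_ _≡_ f)
                  (f-range : ∀ i → lo ≤ f i × f i < lo + N) where

  hit : Fin N → Bool
  hit w = ⌊ Fin.any? (λ i → f i ≟ lo + toℕ w) ⌋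

  position : Fin p → Fin N
  position i = proj₁ (offset-in (proj₁ (f-range i)) (proj₂ (f-range i)))

  lo+position : ∀ i → lo + toℕ (position i) ≡ f i
  lo+position i = proj₂ (offset-in (proj₁ (f-range i)) (proj₂ (f-range i)))

  hit-position : ∀ i → T (hit (position i))
  hit-position i = fromWitness (i , sym (lo+position i))

  preimage : Fin (count hit) → Fin p
  preimage j = proj₁ (toWitness (select-sound hit j))

  f-preimage : ∀ j → f (preimage j) ≡ lo + toℕ (select hit j)
  f-preimage j = proj₂ (toWitness (select-sound hit j))

  count-hit : count hit ≡ p
  count-hit = ≤-antisym
    (Fin.injective⇒≤ {f = preimage} λ {j} {j'} eq → select-injective hit j j' (Fin.toℕ-injective
      (+-cancelˡ-≡ lo _ _ (trans (sym (f-preimage j)) (trans (cong f eq) (f-preimage j'))))))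
    (Fin.injective⇒≤ {f = λ i → rank hit (position i) (hit-position i)} λ {i} {i'} eq → f-injective
      (trans (sym (lo+position i)) (trans (cong (λ w → lo + toℕ w) (rank-injective hit _ _ _ _ eq)) (lo+position i'))))

  gaps : ℕ
  gaps = count (not ∘ hit)

  p+gaps≡N : p + gaps ≡ N
  p+gaps≡N = trans (cong (_+ gaps) (sym count-hit)) (count+count-not hit)

  gap : Fin gaps → ℕ
  gap j = lo + toℕ (select (not ∘ hit) j)

  gap-injective : Injective _≡_ _≡_ gap
  gap-injective {j} {j'} eq = select-injective (not ∘ hit) j j' (Fin.toℕ-injective (+-cancelˡ-≡ lo _ _ eq))

  gap-range : ∀ j → lo ≤ gap j × gap j < lo + N
  gap-range j = m≤m+n lo _ , +-monoʳ-< lo (Fin.toℕ<n (select (not ∘ hit) j))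

  gap≢f : ∀ j i → f i ≢ gap j
  gap≢f j i eq = not-hit (select-sound (not ∘ hit) j) (fromWitness (i , eq))
    where
    not-hit : ∀ {x} → T (not x) → T x → ⊥
    not-hit {true} () _

  covering : ∀ z → lo ≤ z → z < lo + N → (∃ λ i → f i ≡ z) ⊎ (∃ λ j → gap j ≡ z)
  covering z lo≤z z<lo+N with Fin.any? (λ i → f i ≟ z)
  ... | yes found = inj₁ found
  ... | no  none  = inj₂ (rank (not ∘ hit) w missed , trans (cong (λ u → lo + toℕ u) (select-rank (not ∘ hit) w missed)) lo+w)
    where
    w : Fin N
    w = proj₁ (offset-in lo≤z z<lo+N)
    lo+w : lo + toℕ w ≡ z
    lo+w = proj₂ (offset-in lo≤z z<lo+N)
    missed : T (not (hit w))
    missed with Fin.any? (λ i → f i ≟ lo + toℕ w)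
    ... | yes (i , eq) = none (i , trans eq lo+w)
    ... | no  _        = tt

_≟ᴴ_ : ∀ {p q} → DecidableEquality (HV p q)
a     ≟ᴴ a       = yes refl
d     ≟ᴴ d       = yes refl
b i   ≟ᴴ b i'    = map′ (cong b) (λ { refl → refl }) (i Fin.≟ i')
c i j ≟ᴴ c i' j' = map′ (λ { (refl , refl) → refl }) (λ { refl → refl , refl }) (i Fin.≟ i' ×-dec j Fin.≟ j')
a     ≟ᴴ d       = no λ ()
a     ≟ᴴ b _     = no λ ()
a     ≟ᴴ c _ _   = no λ ()
d     ≟ᴴ a       = no λ ()
d     ≟ᴴ b _     = no λ ()
d     ≟ᴴ c _ _   = no λ ()
b _   ≟ᴴ a       = no λ ()
b _   ≟ᴴ d       = no λ ()
b _   ≟ᴴ c _ _   = no λ ()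
c _ _ ≟ᴴ a       = no λ ()
c _ _ ≟ᴴ d       = no λ ()
c _ _ ≟ᴴ b _     = no λ ()

degree : ∀ {p q} → HV p q → ℕ
degree {p}     a       = p
degree {p} {q} d       = p * q
degree {q = q} (b _)   = suc q
degree         (c _ _) = 2

module WithPendants {p q k : ℕ} (att : Fin k → HV p q) where

  H⁺ : Graph
  H⁺ = attach (Hertz p q) k att

  at : HV p q → Fin k → Bool
  at v r = ⌊ att r ≟ᴴ v ⌋

  pendants : HV p q → ℕ
  pendants v = count (at v)

  at-any : List (HV p q) → Fin k → Bool
  at-any []       r = false
  at-any (v ∷ vs) r = at v r ∨ at-any vs r

  at-fresh : ∀ {u} vs → All (u ≢_) vs → ∀ r → T (at u r) → T (at-any vs r) → ⊥
  at-fresh (v ∷ vs) (u≢v ∷ u∉vs) r at-u at-vs with Equivalence.to T-∨ at-vs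
  ... | inj₁ at-v  = u≢v (trans (sym (toWitness at-u)) (toWitness at-v))
  ... | inj₂ at-vs = at-fresh vs u∉vs r at-u at-vs

  pendants-sum : ∀ vs → Unique vs → sum (map pendants vs) ≡ count (at-any vs)
  pendants-sum []       []              = sym (count-false k)
    where
    count-false : ∀ n → count {n} (λ _ → false) ≡ 0
    count-false zero    = refl
    count-false (suc n) = count-false n
  pendants-sum (v ∷ vs) (v∉vs ∷ unique) =
    trans (cong (_+_ (pendants v)) (pendants-sum vs unique)) (sym (count-∨ (at v) (at-any vs) (at-fresh vs v∉vs)))

  pendants-sum≤ : ∀ vs → Unique vs → sum (map pendants vs) ≤ k
  pendants-sum≤ vs unique = subst (_≤ k) (sym (pendants-sum vs unique)) (count≤ (at-any vs))

  slot : ∀ {v} → v ≢ d → (e : E H⁺) → Incident H⁺ e (inj₁ v) → Fin (degree v) ⊎ Fin (pendants v)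
  slot     _   (inj₁ (ab i))   (inj₁ refl) = inj₁ i
  slot     _   (inj₁ (ab i))   (inj₂ refl) = inj₁ zero
  slot     _   (inj₁ (bc i j)) (inj₁ refl) = inj₁ (suc j)
  slot     _   (inj₁ (bc i j)) (inj₂ refl) = inj₁ zero
  slot     _   (inj₁ (cd i j)) (inj₁ refl) = inj₁ (suc zero)
  slot     v≢d (inj₁ (cd i j)) (inj₂ refl) = ⊥-elim (v≢d refl)
  slot {v} _   (inj₂ r)        (inj₁ r↦v)  = inj₂ (rank (at v) r (fromWitness (Sum.inj₁-injective r↦v)))

  edge : ∀ v → v ≢ d → Fin (degree v) ⊎ Fin (pendants v) → E H⁺
  edge v       _   (inj₂ n)       = inj₂ (select (at v) n)
  edge a       _   (inj₁ i)       = inj₁ (ab i)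
  edge (b i)   _   (inj₁ zero)    = inj₁ (ab i)
  edge (b i)   _   (inj₁ (suc j)) = inj₁ (bc i j)
  edge (c i j) _   (inj₁ zero)    = inj₁ (bc i j)
  edge (c i j) _   (inj₁ (suc _)) = inj₁ (cd i j)
  edge d       v≢d (inj₁ _)       = ⊥-elim (v≢d refl)

  edge-slot : ∀ {v} (v≢d : v ≢ d) e (inc : Incident H⁺ e (inj₁ v)) → edge v v≢d (slot v≢d e inc) ≡ e
  edge-slot     _   (inj₁ (ab i))   (inj₁ refl) = refl
  edge-slot     _   (inj₁ (ab i))   (inj₂ refl) = refl
  edge-slot     _   (inj₁ (bc i j)) (inj₁ refl) = refl
  edge-slot     _   (inj₁ (bc i j)) (inj₂ refl) = refl
  edge-slot     _   (inj₁ (cd i j)) (inj₁ refl) = refl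
  edge-slot     v≢d (inj₁ (cd i j)) (inj₂ refl) = ⊥-elim (v≢d refl)
  edge-slot {v} _   (inj₂ r)        (inj₁ r↦v)  = cong inj₂ (select-rank (at v) r _)

  distinct-colours≤ : ∀ (col : E H⁺ → ℕ) {v} → v ≢ d → ∀ {m} (h : Fin m → ℕ) → Injective _≡_ _≡_ h →
                      (∀ j → ColorsAt H⁺ col (inj₁ v) (h j)) → m ≤ degree v + pendants v
  distinct-colours≤ col {v} v≢d {m} h h-inj coloured = Fin.injective⇒≤ place-injective
    where
    edge-of : Fin m → E H⁺
    edge-of j = proj₁ (coloured j)
    slot-of : Fin m → Fin (degree v) ⊎ Fin (pendants v)
    slot-of j = slot v≢d (edge-of j) (proj₁ (proj₂ (coloured j)))
    place : Fin m → Fin (degree v + pendants v)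
    place j = join _ _ (slot-of j)
    place-injective : Injective _≡_ _≡_ place
    place-injective {i} {j} eq = h-inj (begin
      h i              ≡⟨ proj₂ (proj₂ (coloured i)) ⟨
      col (edge-of i)  ≡⟨ cong col same-edge ⟩
      col (edge-of j)  ≡⟨ proj₂ (proj₂ (coloured j)) ⟩
      h j              ∎)
      where
      open ≡-Reasoning
      same-slot : slot-of i ≡ slot-of j
      same-slot = trans (sym (Fin.splitAt-join _ _ (slot-of i)))
                        (trans (cong (splitAt _) eq) (Fin.splitAt-join _ _ (slot-of j)))
      same-edge : edge-of i ≡ edge-of j
      same-edge = trans (sym (edge-slot v≢d (edge-of i) _))
                        (trans (cong (edge v v≢d) same-slot) (edge-slot v≢d (edge-of j) _))

  any-edge? : {P : E H⁺ → Set} → (∀ e → Dec (P e)) → Dec (∃ P)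
  any-edge? {P} P? = map′ found search
    (Fin.any? (P? ∘ inj₁ ∘ ab) ⊎-dec
     Fin.any? (λ i → Fin.any? (P? ∘ inj₁ ∘ bc i)) ⊎-dec
     Fin.any? (λ i → Fin.any? (P? ∘ inj₁ ∘ cd i)) ⊎-dec
     Fin.any? (P? ∘ inj₂))
    where
    Search : Set
    Search = (∃ λ i → P (inj₁ (ab i))) ⊎ (∃ λ i → ∃ λ j → P (inj₁ (bc i j)))
           ⊎ (∃ λ i → ∃ λ j → P (inj₁ (cd i j))) ⊎ (∃ λ r → P (inj₂ r))
    found : Search → ∃ P
    found (inj₁ (_ , pe))                   = _ , pe
    found (inj₂ (inj₁ (_ , _ , pe)))        = _ , pe
    found (inj₂ (inj₂ (inj₁ (_ , _ , pe)))) = _ , pe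
    found (inj₂ (inj₂ (inj₂ (_ , pe))))     = _ , pe
    search : ∃ P → Search
    search (inj₁ (ab i)   , pe) = inj₁ (i , pe)
    search (inj₁ (bc i j) , pe) = inj₂ (inj₁ (i , j , pe))
    search (inj₁ (cd i j) , pe) = inj₂ (inj₂ (inj₁ (i , j , pe)))
    search (inj₂ r        , pe) = inj₂ (inj₂ (inj₂ (r , pe)))

  colours? : ∀ col v x → Dec (ColorsAt H⁺ col v x)
  colours? col v x = any-edge? λ e → (vertex? (proj₁ (ends H⁺ e)) ⊎-dec vertex? (proj₂ (ends H⁺ e))) ×-dec (col e ≟ x)
    where
    vertex? : ∀ u → Dec (u ≡ v)
    vertex? u = Sum.≡-dec _≟ᴴ_ Fin._≟_ u v

  module LowerBound (col : E H⁺ → ℕ) (proper : Proper H⁺ col) (t : ℕ)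
    (unwrapping : ∀ v → Unwrapping (ColorsAt H⁺ col (inj₁ v)) t)
    (d-separated : ∀ {x y} → ColorsAt H⁺ col (inj₁ d) x → ColorsAt H⁺ col (inj₁ d) y → + x ≡ + y mod t → x ≡ y)
    where

    Λ : HV p q → ℕ → ℤ
    Λ v x = + Unwrapping.unwrap (unwrapping v) x

    spread : ∀ {v} → v ≢ d → ∀ {x y} → ColorsAt H⁺ col (inj₁ v) x → ColorsAt H⁺ col (inj₁ v) y →
             suc ∣ Λ v x -ᶻ Λ v y ∣ ≤ degree v + pendants v
    spread v≢d cx cy with Unwrapping.unwrap-spans (unwrapping _) cx cy
    ... | m , h , h-inj , coloured , size = ≤-trans size (distinct-colours≤ col v≢d h h-inj coloured)

    α : Fin p → ℕ
    α i = col (inj₁ (ab i))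
    β γ : Fin p → Fin q → ℕ
    β i j = col (inj₁ (bc i j))
    γ i j = col (inj₁ (cd i j))

    path-sum : Fin p → Fin q → ℤ
    path-sum i j = Λ a (α i) +ᶻ (Λ (b i) (β i j) -ᶻ Λ (b i) (α i)) +ᶻ (Λ (c i j) (γ i j) -ᶻ Λ (c i j) (β i j))

    path-sum-≡mod : ∀ i j → path-sum i j ≡ + γ i j mod t
    path-sum-≡mod i j = subst (path-sum i j ≡_mod t) (telescope (+ α i) (+ β i j) (+ γ i j))
      (≡mod-+ (≡mod-+ (unwrap-at a (inj₁ refl)) (≡mod-- (unwrap-at (b i) (inj₁ refl)) (unwrap-at (b i) (inj₂ refl))))
              (≡mod-- (unwrap-at (c i j) (inj₁ refl)) (unwrap-at (c i j) (inj₂ refl))))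
      where
      unwrap-at : ∀ v {e} → Incident H⁺ e (inj₁ v) → Λ v (col e) ≡ + col e mod t
      unwrap-at v inc = Unwrapping.unwrap-≡mod (unwrapping v) (_ , inc , refl)
      telescope : ∀ x y z → x +ᶻ (y -ᶻ x) +ᶻ (z -ᶻ y) ≡ z
      telescope = solve-∀

    path-sum-injective : ∀ {i j i' j'} → path-sum i j ≡ path-sum i' j' → (i , j) ≡ (i' , j')
    path-sum-injective {i} {j} {i'} {j'} eq with i Fin.≟ i' ×-dec j Fin.≟ j'
    ... | yes (refl , refl) = refl
    ... | no differ = ⊥-elim (proper (inj₁ (cd i j)) (inj₁ (cd i' j')) (inj₁ d)
                        (λ { refl → differ (refl , refl) }) (inj₂ refl) (inj₂ refl) same-colour)
      where
      same-colour : γ i j ≡ γ i' j'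
      same-colour = d-separated (_ , inj₂ refl , refl) (_ , inj₂ refl , refl)
        (≡mod-trans (≡mod-sym (path-sum-≡mod i j)) (subst (_≡ + γ i' j' mod t) (sym eq) (path-sum-≡mod i' j')))

    capacity : HV p q → ℕ
    capacity v = degree v + pendants v

    colour-of : ∀ e {v} → Incident H⁺ e (inj₁ v) → ColorsAt H⁺ col (inj₁ v) (col e)
    colour-of e inc = e , inc , refl

    spread-across-rows : ∀ i j i' j' → Σ ℤ λ Δ → path-sum i j -ᶻ path-sum i' j' ≡ Δ ×
      (i ≢ i' → ∣ Δ ∣ + 5 ≤ 0 + capacity a + capacity (b i) + capacity (b i') + capacity (c i j) + capacity (c i' j'))
    spread-across-rows i j i' j' = Δ , split , accumulated
      where
      ΔA ΔB ΔB' ΔC ΔC' Δ : ℤ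
      ΔA = Λ a (α i) -ᶻ Λ a (α i')
      ΔB = Λ (b i) (β i j) -ᶻ Λ (b i) (α i)
      ΔB' = Λ (b i') (α i') -ᶻ Λ (b i') (β i' j')
      ΔC = Λ (c i j) (γ i j) -ᶻ Λ (c i j) (β i j)
      ΔC' = Λ (c i' j') (β i' j') -ᶻ Λ (c i' j') (γ i' j')
      Δ = 0ℤ +ᶻ ΔA +ᶻ ΔB +ᶻ ΔB' +ᶻ ΔC +ᶻ ΔC'
      split : path-sum i j -ᶻ path-sum i' j' ≡ Δ
      split = lemma (Λ a (α i)) (Λ a (α i')) (Λ (b i) (β i j)) (Λ (b i) (α i)) (Λ (b i') (β i' j')) (Λ (b i') (α i'))
                    (Λ (c i j) (γ i j)) (Λ (c i j) (β i j)) (Λ (c i' j') (γ i' j')) (Λ (c i' j') (β i' j'))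
        where
        lemma : ∀ A A' B₁ B₂ B₁' B₂' C₁ C₂ C₁' C₂' →
                A +ᶻ (B₁ -ᶻ B₂) +ᶻ (C₁ -ᶻ C₂) -ᶻ (A' +ᶻ (B₁' -ᶻ B₂') +ᶻ (C₁' -ᶻ C₂')) ≡
                0ℤ +ᶻ (A -ᶻ A') +ᶻ (B₁ -ᶻ B₂) +ᶻ (B₂' -ᶻ B₁') +ᶻ (C₁ -ᶻ C₂) +ᶻ (C₂' -ᶻ C₁')
        lemma = solve-∀
      accumulated : i ≢ i' →
        ∣ Δ ∣ + 5 ≤ 0 + capacity a + capacity (b i) + capacity (b i') + capacity (c i j) + capacity (c i' j')
      accumulated i≢i' =
        ∣+∣-accumulate (0ℤ +ᶻ ΔA +ᶻ ΔB +ᶻ ΔB' +ᶻ ΔC) ΔC'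
          (∣+∣-accumulate (0ℤ +ᶻ ΔA +ᶻ ΔB +ᶻ ΔB') ΔC
            (∣+∣-accumulate (0ℤ +ᶻ ΔA +ᶻ ΔB) ΔB'
              (∣+∣-accumulate (0ℤ +ᶻ ΔA) ΔB
                (∣+∣-accumulate 0ℤ ΔA {0} {0} z≤n
                  (spread {a} (λ ()) (colour-of (inj₁ (ab i)) (inj₁ refl)) (colour-of (inj₁ (ab i')) (inj₁ refl))))
                (spread {b i} (λ ()) (colour-of (inj₁ (bc i j)) (inj₁ refl)) (colour-of (inj₁ (ab i)) (inj₂ refl))))
              (spread {b i'} (λ ()) (colour-of (inj₁ (ab i')) (inj₂ refl)) (colour-of (inj₁ (bc i' j')) (inj₁ refl))))
            (spread {c i j} (λ ()) (colour-of (inj₁ (cd i j)) (inj₁ refl)) (colour-of (inj₁ (bc i j)) (inj₂ refl))))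
          (spread {c i' j'} (λ ()) (colour-of (inj₁ (bc i' j')) (inj₂ refl)) (colour-of (inj₁ (cd i' j')) (inj₁ refl)))

    rows-apart : ∀ {i i'} j j' → i ≢ i' → ∣ path-sum i j -ᶻ path-sum i' j' ∣ ≤ p + 2 * q + 1 + k
    rows-apart {i} {i'} j j' i≢i' with spread-across-rows i j i' j'
    ... | Δ , split , accumulated = +-cancelˡ-≤ 5 _ _ (begin
      5 + ∣ path-sum i j -ᶻ path-sum i' j' ∣  ≡⟨ cong (λ x → 5 + ∣ x ∣) split ⟩
      5 + ∣ Δ ∣                                ≡⟨ +-comm 5 _ ⟩
      ∣ Δ ∣ + 5                                ≤⟨ accumulated i≢i' ⟩
      0 + capacity a + capacity (b i) + capacity (b i') + capacity (c i j) + capacity (c i' j')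
        ≡⟨ collect p q (pendants a) (pendants (b i)) (pendants (b i')) (pendants (c i j)) (pendants (c i' j')) ⟩
      5 + (p + 2 * q + 1) + sum (map pendants (a ∷ b i ∷ b i' ∷ c i j ∷ c i' j' ∷ []))
        ≤⟨ +-monoʳ-≤ (5 + (p + 2 * q + 1)) (pendants-sum≤ _ distinct) ⟩
      5 + (p + 2 * q + 1) + k                  ≡⟨ +-assoc 5 _ k ⟩
      5 + (p + 2 * q + 1 + k)                  ∎)
      where
      open ≤-Reasoning
      collect : ∀ p q na nb nb' nc nc' →
                0 + (p + na) + (suc q + nb) + (suc q + nb') + (2 + nc) + (2 + nc') ≡
                5 + (p + 2 * q + 1) + (na + (nb + (nb' + (nc + (nc' + 0)))))
      collect = ℕ-Solver.solve-∀
      distinct : Unique (a ∷ b i ∷ b i' ∷ c i j ∷ c i' j' ∷ [])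
      distinct = ((λ ()) ∷ (λ ()) ∷ (λ ()) ∷ (λ ()) ∷ [])
               ∷ ((λ { refl → i≢i' refl }) ∷ (λ ()) ∷ (λ ()) ∷ [])
               ∷ ((λ ()) ∷ (λ ()) ∷ [])
               ∷ ((λ { refl → i≢i' refl }) ∷ [])
               ∷ [] ∷ []

    spread-within-row : ∀ i j j' → Σ ℤ λ Δ → path-sum i j -ᶻ path-sum i j' ≡ Δ ×
      ∣ Δ ∣ + 3 ≤ 0 + capacity (b i) + capacity (c i j) + capacity (c i j')
    spread-within-row i j j' = Δ , split , accumulated
      where
      ΔB ΔC ΔC' Δ : ℤ
      ΔB = Λ (b i) (β i j) -ᶻ Λ (b i) (β i j')
      ΔC = Λ (c i j) (γ i j) -ᶻ Λ (c i j) (β i j)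
      ΔC' = Λ (c i j') (β i j') -ᶻ Λ (c i j') (γ i j')
      Δ = 0ℤ +ᶻ ΔB +ᶻ ΔC +ᶻ ΔC'
      split : path-sum i j -ᶻ path-sum i j' ≡ Δ
      split = lemma (Λ a (α i)) (Λ (b i) (β i j)) (Λ (b i) (β i j')) (Λ (b i) (α i))
                    (Λ (c i j) (γ i j)) (Λ (c i j) (β i j)) (Λ (c i j') (γ i j')) (Λ (c i j') (β i j'))
        where
        lemma : ∀ A B₁ B₁' B₂ C₁ C₂ C₁' C₂' →
                A +ᶻ (B₁ -ᶻ B₂) +ᶻ (C₁ -ᶻ C₂) -ᶻ (A +ᶻ (B₁' -ᶻ B₂) +ᶻ (C₁' -ᶻ C₂')) ≡
                0ℤ +ᶻ (B₁ -ᶻ B₁') +ᶻ (C₁ -ᶻ C₂) +ᶻ (C₂' -ᶻ C₁')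
        lemma = solve-∀
      accumulated : ∣ Δ ∣ + 3 ≤ 0 + capacity (b i) + capacity (c i j) + capacity (c i j')
      accumulated =
        ∣+∣-accumulate (0ℤ +ᶻ ΔB +ᶻ ΔC) ΔC'
          (∣+∣-accumulate (0ℤ +ᶻ ΔB) ΔC
            (∣+∣-accumulate 0ℤ ΔB {0} {0} z≤n
              (spread {b i} (λ ()) (colour-of (inj₁ (bc i j)) (inj₁ refl)) (colour-of (inj₁ (bc i j')) (inj₁ refl))))
            (spread {c i j} (λ ()) (colour-of (inj₁ (cd i j)) (inj₁ refl)) (colour-of (inj₁ (bc i j)) (inj₂ refl))))
          (spread {c i j'} (λ ()) (colour-of (inj₁ (bc i j')) (inj₂ refl)) (colour-of (inj₁ (cd i j')) (inj₁ refl)))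

    within-row : ∀ i {j j'} → j ≢ j' → ∣ path-sum i j -ᶻ path-sum i j' ∣ ≤ q + 2 + k
    within-row i {j} {j'} j≢j' with spread-within-row i j j'
    ... | Δ , split , accumulated = +-cancelˡ-≤ 3 _ _ (begin
      3 + ∣ path-sum i j -ᶻ path-sum i j' ∣  ≡⟨ cong (λ x → 3 + ∣ x ∣) split ⟩
      3 + ∣ Δ ∣                               ≡⟨ +-comm 3 _ ⟩
      ∣ Δ ∣ + 3                               ≤⟨ accumulated ⟩
      0 + capacity (b i) + capacity (c i j) + capacity (c i j')
        ≡⟨ collect q (pendants (b i)) (pendants (c i j)) (pendants (c i j')) ⟩
      3 + (q + 2) + sum (map pendants (b i ∷ c i j ∷ c i j' ∷ []))
        ≤⟨ +-monoʳ-≤ (3 + (q + 2)) (pendants-sum≤ _ distinct) ⟩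
      3 + (q + 2) + k                         ≡⟨ +-assoc 3 _ k ⟩
      3 + (q + 2 + k)                         ∎)
      where
      open ≤-Reasoning
      collect : ∀ q nb nc nc' → 0 + (suc q + nb) + (2 + nc) + (2 + nc') ≡ 3 + (q + 2) + (nb + (nc + (nc' + 0)))
      collect = ℕ-Solver.solve-∀
      distinct : Unique (b i ∷ c i j ∷ c i j' ∷ [])
      distinct = ((λ ()) ∷ (λ ()) ∷ []) ∷ ((λ { refl → j≢j' refl }) ∷ []) ∷ [] ∷ []

    path-sums-close : ∀ i j i' j' → ∣ path-sum i j -ᶻ path-sum i' j' ∣ ≤ p + 2 * q + 1 + k
    path-sums-close i j i' j' with i Fin.≟ i' | j Fin.≟ j'
    ... | no i≢i'  | _        = rows-apart j j' i≢i'
    ... | yes refl | no j≢j'  = ≤-trans (within-row i j≢j') (+-monoˡ-≤ k (q+2≤ (≤-<-trans z≤n (Fin.toℕ<n i))))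
      where
      q+2≤ : 0 < p → q + 2 ≤ p + 2 * q + 1
      q+2≤ 0<p = begin
        q + 2              ≡⟨ +-comm q 2 ⟩
        1 + (1 + q)        ≤⟨ +-monoˡ-≤ (1 + q) 0<p ⟩
        p + (1 + q)        ≤⟨ m≤m+n (p + (1 + q)) q ⟩
        p + (1 + q) + q    ≡⟨ rearrange p q ⟩
        p + 2 * q + 1      ∎
        where
        open ≤-Reasoning
        rearrange : ∀ p q → p + (1 + q) + q ≡ p + 2 * q + 1
        rearrange = ℕ-Solver.solve-∀
    ... | yes refl | yes refl = subst (_≤ p + 2 * q + 1 + k) (sym (cong ∣_∣ (ℤₚ.+-inverseʳ (path-sum i j)))) z≤n

    vertices≤ : p * q ≤ p + (2 * q + (2 + k))
    vertices≤ = subst (p * q ≤_) (rearrange p q k)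
      (close-injective⇒≤ (p + 2 * q + 1 + k) path-sum′ path-sum′-injective
        λ n n' → path-sums-close _ _ _ _)
      where
      path-sum′ : Fin (p * q) → ℤ
      path-sum′ n = path-sum (proj₁ (remQuot {p} q n)) (proj₂ (remQuot {p} q n))
      path-sum′-injective : Injective _≡_ _≡_ path-sum′
      path-sum′-injective {n} {n'} eq = trans (sym (Fin.combine-remQuot {p} q n))
        (trans (cong (λ ij → combine (proj₁ ij) (proj₂ ij)) same-path) (Fin.combine-remQuot {p} q n'))
        where
        same-path : remQuot {p} q n ≡ remQuot q n'
        same-path = path-sum-injective {proj₁ (remQuot {p} q n)} {proj₂ (remQuot {p} q n)} eq
      rearrange : ∀ p q k → suc (p + 2 * q + 1 + k) ≡ p + (2 * q + (2 + k))
      rearrange = ℕ-Solver.solve-∀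

    deficiency≤pendants : p * q ∸ p ∸ 2 * q ∸ 2 ≤ k
    deficiency≤pendants =
      m≤n+o⇒m∸n≤o _ 2 (m≤n+o⇒m∸n≤o _ (2 * q) (m≤n+o⇒m∸n≤o (p * q) p vertices≤))

  cyclic-deficiency≤pendants : HasCyclicIntervalColoring H⁺ → p * q ∸ p ∸ 2 * q ∸ 2 ≤ k
  cyclic-deficiency≤pendants (t , col , bounded , proper , cyclic) =
    LowerBound.deficiency≤pendants col proper t
      (λ v → cyclic-unwrapping t (colours? col (inj₁ v)) in-range (cyclic (inj₁ v)))
      (λ cx cy x≡y → ℤₚ.+-injective (≡mod-close⇒≡ x≡y
         (∣+m-+n∣<t (proj₁ (in-range cx)) (proj₂ (in-range cx)) (proj₁ (in-range cy)) (proj₂ (in-range cy)))))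
    where
    in-range : ∀ {v x} → ColorsAt H⁺ col v x → 1 ≤ x × x ≤ t
    in-range (e , _ , refl) = bounded e

  deficiency≤pendants : HasIntervalColoring H⁺ → p * q ∸ p ∸ 2 * q ∸ 2 ≤ k
  deficiency≤pendants (col , _ , proper , interval) =
    LowerBound.deficiency≤pendants col proper 0 (λ v → interval-unwrapping 0 (interval (inj₁ v)))
      (λ _ _ x≡y → ℤₚ.+-injective (≡mod0⇒≡ x≡y))

<-by : ∀ {m n} x → m + suc x ≡ n → m < n
<-by {m} x eq = subst (m <_) eq (m<m+n m z<s)

module Construction (p' q' : ℕ) where

  p q : ℕ
  p = 4 + p'
  q = 3 + q'

  data Row : ℕ → Set where
    first       : Row 0
    middle      : ∀ m → m ≤ p' → Row (suc m)
    penultimate : Row (2 + p')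
    last        : Row (3 + p')

  row : ∀ n → n < p → Row n
  row zero    _  = first
  row (suc m) lt with m ≤? p' | m ≟ suc p'
  ... | yes m≤p' | _        = middle m m≤p'
  ... | no  _    | yes refl = penultimate
  ... | no  m≰p' | no  m≢   = subst (Row ∘ suc) (sym m≡2+p') last
    where
    m≡2+p' : m ≡ 2 + p'
    m≡2+p' = ≤-antisym (s≤s⁻¹ (s≤s⁻¹ lt)) (≤∧≢⇒< (≰⇒> m≰p') (m≢ ∘ sym))

  Row-bounded : ∀ {n} → Row n → n < p
  Row-bounded first           = s≤s z≤n
  Row-bounded (middle m m≤p') = s≤s (s≤s (≤-trans m≤p' (≤-trans (n≤1+n p') (n≤1+n _))))
  Row-bounded penultimate     = s≤s (s≤s (s≤s (n≤1+n _)))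
  Row-bounded last            = ≤-refl

  -- The first and last rows put a b_i on the far side of their block, which keeps the colours
  -- at a within [q + 3, (p − 1) q].
  ab-colour : ∀ {n} → Row n → ℕ
  ab-colour first        = q + 3
  ab-colour (middle m _) = q * suc m + 1 + q
  ab-colour penultimate  = q * (2 + p') + 2
  ab-colour last         = q * (3 + p')

  bc-start : ∀ {n} → Row n → ℕ
  bc-start first        = 3
  bc-start (middle m _) = q * suc m + 1
  bc-start penultimate  = q * (2 + p') + 3
  bc-start last         = q * (3 + p') + 1

  ab-next-to-bc : ∀ {n} (r : Row n) → ab-colour r ≡ bc-start r + q ⊎ bc-start r ≡ suc (ab-colour r)
  ab-next-to-bc first        = inj₁ (+-comm q 3)
  ab-next-to-bc (middle m _) = inj₁ refl
  ab-next-to-bc penultimate  = inj₂ (+-suc (q * (2 + p')) 2)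
  ab-next-to-bc last         = inj₂ (+-comm (q * (3 + p')) 1)

  bc-start-shape : ∀ {n} (r : Row n) → bc-start r ≡ q * n + 3 ⊎ bc-start r ≡ q * n + 1
  bc-start-shape first        = inj₁ (cong (_+ 3) (sym (*-zeroʳ q)))
  bc-start-shape (middle m _) = inj₂ refl
  bc-start-shape penultimate  = inj₁ refl
  bc-start-shape last         = inj₂ refl

  ab-step : ∀ {n} (r : Row n) (r' : Row (suc n)) → ab-colour r < ab-colour r'
  ab-step first (middle 0 _) = <-by q' (lemma q')
    where lemma : ∀ q' → 3 + q' + 3 + suc q' ≡ (3 + q') * 1 + 1 + (3 + q')
          lemma = ℕ-Solver.solve-∀
  ab-step (middle m _) (middle (suc m) _) = <-by (2 + q') (lemma q' m)
    where lemma : ∀ q' m → (3 + q') * suc m + 1 + (3 + q') + suc (2 + q') ≡ (3 + q') * suc (suc m) + 1 + (3 + q')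
          lemma = ℕ-Solver.solve-∀
  ab-step (middle m _) penultimate = <-by 0 (lemma q' p')
    where lemma : ∀ q' p' → (3 + q') * suc p' + 1 + (3 + q') + 1 ≡ (3 + q') * (2 + p') + 2
          lemma = ℕ-Solver.solve-∀
  ab-step penultimate last = <-by q' (lemma q' p')
    where lemma : ∀ q' p' → (3 + q') * (2 + p') + 2 + suc q' ≡ (3 + q') * (3 + p')
          lemma = ℕ-Solver.solve-∀
  ab-step (middle m m≤p') last = ⊥-elim (1+n≰n m≤p')
  ab-step penultimate (middle m m≤p') = ⊥-elim (1+n≰n (≤-trans (n≤1+n _) m≤p'))
  ab-step last (middle m m≤p') = ⊥-elim (1+n≰n (≤-trans (≤-trans (n≤1+n _) (n≤1+n _)) m≤p'))

  ab-increasing : ∀ {m n} (r : Row m) (r' : Row n) → m < n → ab-colour r < ab-colour r'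
  ab-increasing {m} {suc n} r r' (s≤s m≤n) with m ≟ n
  ... | yes refl = ab-step r r'
  ... | no  m≢n  = <-trans (ab-increasing r r'' (≤∧≢⇒< m≤n m≢n)) (ab-step r'' r')
    where
    r'' : Row n
    r'' = row n (<-trans (n<1+n n) (Row-bounded r'))

  ab-range : ∀ {n} (r : Row n) → ab-colour first ≤ ab-colour r × ab-colour r ≤ ab-colour last
  ab-range first          = ≤-refl , <⇒≤ (ab-increasing first last z<s)
  ab-range r@(middle _ m≤p') = <⇒≤ (ab-increasing first r z<s) , <⇒≤ (ab-increasing r last (s≤s (s≤s (m≤n⇒m≤1+n m≤p'))))
  ab-range penultimate    = <⇒≤ (ab-increasing first penultimate z<s) , <⇒≤ (ab-increasing penultimate last ≤-refl)
  ab-range last           = <⇒≤ (ab-increasing first last z<s) , ≤-refl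

  row-of : (i : Fin p) → Row (toℕ i)
  row-of i = row (toℕ i) (Fin.toℕ<n i)

  α : Fin p → ℕ
  α i = ab-colour (row-of i)

  α-injective : Injective _≡_ _≡_ α
  α-injective {i} {i'} eq with <-cmp (toℕ i) (toℕ i')
  ... | tri< lt _ _ = ⊥-elim (<-irrefl eq (ab-increasing (row-of i) (row-of i') lt))
  ... | tri≈ _ eq' _ = Fin.toℕ-injective eq'
  ... | tri> _ _ gt = ⊥-elim (<-irrefl (sym eq) (ab-increasing (row-of i') (row-of i) gt))

  deficiency : ℕ
  deficiency = p' * q' + 2 * p' + 2 * q'

  deficiency-≡ : p * q ∸ p ∸ 2 * q ∸ 2 ≡ deficiency
  deficiency-≡ = begin
    p * q ∸ p ∸ 2 * q ∸ 2                          ≡⟨ cong (λ x → x ∸ p ∸ 2 * q ∸ 2) (expand p' q') ⟩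
    deficiency + 2 + 2 * q + p ∸ p ∸ 2 * q ∸ 2     ≡⟨ cong (λ x → x ∸ 2 * q ∸ 2) (m+n∸n≡m (deficiency + 2 + 2 * q) p) ⟩
    deficiency + 2 + 2 * q ∸ 2 * q ∸ 2             ≡⟨ cong (_∸ 2) (m+n∸n≡m (deficiency + 2) (2 * q)) ⟩
    deficiency + 2 ∸ 2                             ≡⟨ m+n∸n≡m deficiency 2 ⟩
    deficiency                                     ∎
    where
    open ≡-Reasoning
    expand : ∀ p' q' → (4 + p') * (3 + q') ≡ p' * q' + 2 * p' + 2 * q' + 2 + 2 * (3 + q') + (4 + p')
    expand = ℕ-Solver.solve-∀

  window : ab-colour first + (p + deficiency) ≡ suc (ab-colour last)
  window = lemma p' q'
    where lemma : ∀ p' q' → 3 + q' + 3 + (4 + p' + (p' * q' + 2 * p' + 2 * q')) ≡ suc ((3 + q') * (3 + p'))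
          lemma = ℕ-Solver.solve-∀

  α-range : ∀ i → ab-colour first ≤ α i × α i < ab-colour first + (p + deficiency)
  α-range i = proj₁ (ab-range (row-of i)) , subst (α i <_) (sym window) (s≤s (proj₂ (ab-range (row-of i))))

  open Complement {N = p + deficiency} (ab-colour first) α α-injective α-range

  gaps≡deficiency : gaps ≡ deficiency
  gaps≡deficiency = +-cancelˡ-≡ p _ _ p+gaps≡N

  G : Graph
  G = attach (Hertz p q) gaps (λ _ → a)

  colour : E G → ℕ
  colour (inj₁ (ab i))   = α i
  colour (inj₁ (bc i j)) = bc-start (row-of i) + toℕ j
  colour (inj₁ (cd i j)) = 2 + toℕ (combine i j)
  colour (inj₂ r)        = gap r

  at-b : ∀ {i e} → Incident G e (inj₁ (b i)) → e ≡ inj₁ (ab i) ⊎ ∃ λ j → e ≡ inj₁ (bc i j)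
  at-b {e = inj₁ (ab _)}   (inj₂ refl) = inj₁ refl
  at-b {e = inj₁ (bc _ j)} (inj₁ refl) = inj₂ (j , refl)

  at-a : ∀ {e} → Incident G e (inj₁ a) → (∃ λ i → e ≡ inj₁ (ab i)) ⊎ (∃ λ r → e ≡ inj₂ r)
  at-a {inj₁ (ab i)} (inj₁ refl) = inj₁ (i , refl)
  at-a {inj₂ r}      (inj₁ refl) = inj₂ (r , refl)
  at-a {inj₁ (ab _)}   (inj₂ ())
  at-a {inj₁ (bc _ _)} (inj₂ ())
  at-a {inj₁ (cd _ _)} (inj₂ ())

  at-c : ∀ {i j e} → Incident G e (inj₁ (c i j)) → e ≡ inj₁ (bc i j) ⊎ e ≡ inj₁ (cd i j)
  at-c {e = inj₁ (bc _ _)} (inj₂ refl) = inj₁ refl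
  at-c {e = inj₁ (cd _ _)} (inj₁ refl) = inj₂ refl

  at-d : ∀ {e} → Incident G e (inj₁ d) → ∃ λ i → ∃ λ j → e ≡ inj₁ (cd i j)
  at-d {inj₁ (cd i j)} (inj₂ refl) = i , j , refl
  at-d {inj₁ (ab _)}   (inj₁ ())
  at-d {inj₁ (bc _ _)} (inj₁ ())
  at-d {inj₁ (cd _ _)} (inj₁ ())

  at-pendant : ∀ {r e} → Incident G e (inj₂ r) → e ≡ inj₂ r
  at-pendant {e = inj₂ _}      (inj₂ refl) = refl
  at-pendant {e = inj₁ (ab _)}   (inj₁ ())
  at-pendant {e = inj₁ (bc _ _)} (inj₁ ())
  at-pendant {e = inj₁ (cd _ _)} (inj₁ ())

  Colour : V G → ℕ → Set
  Colour = ColorsAt G colour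

  LocallyInjective : V G → Set
  LocallyInjective v = ∀ {e e'} → Incident G e v → Incident G e' v → colour e ≡ colour e' → e ≡ e'

  a-injective : LocallyInjective (inj₁ a)
  a-injective {e} {e'} inc inc' = by-cases (at-a inc) (at-a inc')
    where
    by-cases : (∃ λ i → e ≡ inj₁ (ab i)) ⊎ (∃ λ r → e ≡ inj₂ r) → (∃ λ i → e' ≡ inj₁ (ab i)) ⊎ (∃ λ r → e' ≡ inj₂ r) →
               colour e ≡ colour e' → e ≡ e'
    by-cases (inj₁ (i , refl)) (inj₁ (i' , refl)) eq = cong (inj₁ ∘ ab) (α-injective eq)
    by-cases (inj₁ (i , refl)) (inj₂ (r , refl))  eq = ⊥-elim (gap≢f r i eq)
    by-cases (inj₂ (r , refl)) (inj₁ (i , refl))  eq = ⊥-elim (gap≢f r i (sym eq))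
    by-cases (inj₂ (r , refl)) (inj₂ (r' , refl)) eq = cong inj₂ (gap-injective eq)

  a-colour-range : ∀ {e} → Incident G e (inj₁ a) → ab-colour first ≤ colour e × colour e ≤ ab-colour last
  a-colour-range {e} inc = by-cases (at-a inc)
    where
    below-window : ∀ {z} → z < ab-colour first + (p + deficiency) → z ≤ ab-colour last
    below-window {z} z< = s≤s⁻¹ (subst (z <_) window z<)
    by-cases : (∃ λ i → e ≡ inj₁ (ab i)) ⊎ (∃ λ r → e ≡ inj₂ r) →
               ab-colour first ≤ colour e × colour e ≤ ab-colour last
    by-cases (inj₁ (i , refl)) = proj₁ (α-range i) , below-window (proj₂ (α-range i))
    by-cases (inj₂ (r , refl)) = proj₁ (gap-range r) , below-window (proj₂ (gap-range r))

  a-interval : IsInterval (Colour (inj₁ a))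
  a-interval = interval-of-range (ab-colour first) (ab-colour last) (λ { (e , inc , refl) → a-colour-range {e} inc }) complete
    where
    complete : ∀ {z} → ab-colour first ≤ z → z ≤ ab-colour last → Colour (inj₁ a) z
    complete {z} lo≤z z≤hi with covering z lo≤z (subst (z <_) (sym window) (s≤s z≤hi))
    ... | inj₁ (i , eq) = inj₁ (ab i) , inj₁ refl , eq
    ... | inj₂ (r , eq) = inj₂ r , inj₁ refl , eq

  b-injective : ∀ i → LocallyInjective (inj₁ (b i))
  b-injective i {e} {e'} inc inc' = by-cases (at-b inc) (at-b inc')
    where
    by-cases : e ≡ inj₁ (ab i) ⊎ (∃ λ j → e ≡ inj₁ (bc i j)) → e' ≡ inj₁ (ab i) ⊎ (∃ λ j → e' ≡ inj₁ (bc i j)) →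
               colour e ≡ colour e' → e ≡ e'
    by-cases (inj₁ refl)       (inj₁ refl)        _  = refl
    by-cases (inj₁ refl)       (inj₂ (j , refl))  eq = ⊥-elim (adjacent∉block (ab-next-to-bc (row-of i)) (Fin.toℕ<n j) eq)
    by-cases (inj₂ (j , refl)) (inj₁ refl)        eq = ⊥-elim (adjacent∉block (ab-next-to-bc (row-of i)) (Fin.toℕ<n j) (sym eq))
    by-cases (inj₂ (j , refl)) (inj₂ (j' , refl)) eq = cong (inj₁ ∘ bc i) (Fin.toℕ-injective (+-cancelˡ-≡ _ _ _ eq))

  b-interval : ∀ i → IsInterval (Colour (inj₁ (b i)))
  b-interval i = block-with-neighbour-interval (ab-next-to-bc (row-of i))
    (inj₁ (ab i) , inj₂ refl , refl) (λ j → inj₁ (bc i j) , inj₁ refl , refl)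
    λ { (e , inc , refl) → only (at-b {i} {e} inc) }
    where
    only : ∀ {e} → e ≡ inj₁ (ab i) ⊎ (∃ λ j → e ≡ inj₁ (bc i j)) →
           colour e ≡ α i ⊎ ∃ λ j → colour e ≡ bc-start (row-of i) + toℕ j
    only (inj₁ refl)       = inj₁ refl
    only (inj₂ (j , refl)) = inj₂ (j , refl)

  cd-next-to-bc : ∀ i j → Adjacent-to-block (colour (inj₁ (cd i j))) (colour (inj₁ (bc i j))) 1
  cd-next-to-bc i j with bc-start-shape (row-of i)
  ... | inj₁ eq = inj₂ (begin
    bc-start (row-of i) + toℕ j          ≡⟨ cong (_+ toℕ j) eq ⟩
    q * toℕ i + 3 + toℕ j                ≡⟨ lemma (q * toℕ i) (toℕ j) ⟩
    3 + (q * toℕ i + toℕ j)              ≡⟨ cong (_+_ 3) (Fin.toℕ-combine i j) ⟨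
    3 + toℕ (combine i j)                ∎)
    where
    open ≡-Reasoning
    lemma : ∀ x y → x + 3 + y ≡ 3 + (x + y)
    lemma = ℕ-Solver.solve-∀
  ... | inj₂ eq = inj₁ (begin
    2 + toℕ (combine i j)                ≡⟨ cong (_+_ 2) (Fin.toℕ-combine i j) ⟩
    2 + (q * toℕ i + toℕ j)              ≡⟨ lemma (q * toℕ i) (toℕ j) ⟩
    q * toℕ i + 1 + toℕ j + 1            ≡⟨ cong (λ s → s + toℕ j + 1) eq ⟨
    bc-start (row-of i) + toℕ j + 1      ∎)
    where
    open ≡-Reasoning
    lemma : ∀ x y → 2 + (x + y) ≡ x + 1 + y + 1
    lemma = ℕ-Solver.solve-∀

  c-injective : ∀ i j → LocallyInjective (inj₁ (c i j))
  c-injective i j {e} {e'} inc inc' = by-cases (at-c inc) (at-c inc')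
    where
    bc≢cd : colour (inj₁ (bc i j)) ≢ colour (inj₁ (cd i j))
    bc≢cd eq = adjacent∉block (cd-next-to-bc i j) z<s (trans (sym eq) (sym (+-identityʳ _)))
    by-cases : e ≡ inj₁ (bc i j) ⊎ e ≡ inj₁ (cd i j) → e' ≡ inj₁ (bc i j) ⊎ e' ≡ inj₁ (cd i j) →
               colour e ≡ colour e' → e ≡ e'
    by-cases (inj₁ refl) (inj₁ refl) _  = refl
    by-cases (inj₁ refl) (inj₂ refl) eq = ⊥-elim (bc≢cd eq)
    by-cases (inj₂ refl) (inj₁ refl) eq = ⊥-elim (bc≢cd (sym eq))
    by-cases (inj₂ refl) (inj₂ refl) _  = refl

  c-interval : ∀ i j → IsInterval (Colour (inj₁ (c i j)))
  c-interval i j = block-with-neighbour-interval (cd-next-to-bc i j)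
    (inj₁ (cd i j) , inj₁ refl , refl)
    (λ { zero → inj₁ (bc i j) , inj₂ refl , sym (+-identityʳ (colour (inj₁ (bc i j)))) })
    λ { (e , inc , refl) → only (at-c {i} {j} {e} inc) }
    where
    only : ∀ {e} → e ≡ inj₁ (bc i j) ⊎ e ≡ inj₁ (cd i j) →
           colour e ≡ colour (inj₁ (cd i j)) ⊎ ∃ λ (k : Fin 1) → colour e ≡ colour (inj₁ (bc i j)) + toℕ k
    only (inj₁ refl) = inj₂ (zero , sym (+-identityʳ (colour (inj₁ (bc i j)))))
    only (inj₂ refl) = inj₁ refl

  d-colour-range : ∀ i j → 2 ≤ colour (inj₁ (cd i j)) × colour (inj₁ (cd i j)) ≤ 1 + p * q
  d-colour-range i j = m≤m+n 2 (toℕ (combine i j)) , s≤s (Fin.toℕ<n (combine i j))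

  d-injective : LocallyInjective (inj₁ d)
  d-injective {e} {e'} inc inc' = by-cases (at-d inc) (at-d inc')
    where
    by-cases : (∃ λ i → ∃ λ j → e ≡ inj₁ (cd i j)) → (∃ λ i → ∃ λ j → e' ≡ inj₁ (cd i j)) → colour e ≡ colour e' → e ≡ e'
    by-cases (i , j , refl) (i' , j' , refl) eq
      with refl , refl ← Fin.combine-injective i j i' j' (Fin.toℕ-injective (+-cancelˡ-≡ 2 _ _ eq)) = refl

  d-interval : IsInterval (Colour (inj₁ d))
  d-interval = interval-of-range 2 (1 + p * q) (λ { (e , inc , refl) → sound (at-d {e} inc) }) complete
    where
    sound : ∀ {e} → (∃ λ i → ∃ λ j → e ≡ inj₁ (cd i j)) → 2 ≤ colour e × colour e ≤ 1 + p * q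
    sound (i , j , refl) = d-colour-range i j
    complete : ∀ {z} → 2 ≤ z → z ≤ 1 + p * q → Colour (inj₁ d) z
    complete 2≤z z≤ with offset-in {n = p * q} 2≤z (s≤s z≤)
    ... | w , 2+w≡z = inj₁ (cd (proj₁ (remQuot {p} q w)) (proj₂ (remQuot {p} q w))) , inj₂ refl ,
                      trans (cong (λ u → 2 + toℕ u) (Fin.combine-remQuot {p} q w)) 2+w≡z

  pendant-injective : ∀ r → LocallyInjective (inj₂ r)
  pendant-injective r inc inc' _ = trans (at-pendant inc) (sym (at-pendant inc'))

  pendant-interval : ∀ r → IsInterval (Colour (inj₂ r))
  pendant-interval r = interval-of-range (gap r) (gap r) (λ { (e , inc , refl) → only (at-pendant {r} {e} inc) })
                                          (λ lo hi → inj₂ r , inj₂ refl , ≤-antisym lo hi)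
    where
    only : ∀ {e} → e ≡ inj₂ r → gap r ≤ colour e × colour e ≤ gap r
    only refl = ≤-refl , ≤-refl

  locally-injective : ∀ v → LocallyInjective v
  locally-injective (inj₁ a)       = a-injective
  locally-injective (inj₁ d)       = d-injective
  locally-injective (inj₁ (b i))   = b-injective i
  locally-injective (inj₁ (c i j)) = c-injective i j
  locally-injective (inj₂ r)       = pendant-injective r

  interval-everywhere : ∀ v → IsInterval (Colour v)
  interval-everywhere (inj₁ a)       = a-interval
  interval-everywhere (inj₁ d)       = d-interval
  interval-everywhere (inj₁ (b i))   = b-interval i
  interval-everywhere (inj₁ (c i j)) = c-interval i j
  interval-everywhere (inj₂ r)       = pendant-interval r

  proper : Proper G colour
  proper e e' v e≢e' inc inc' eq = e≢e' (locally-injective v inc inc' eq)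

  a-colour-bounds : ∀ {e} → Incident G e (inj₁ a) → 1 ≤ colour e × colour e ≤ 2 + p * q
  a-colour-bounds {e} inc =
    ≤-trans (s≤s z≤n) (proj₁ (a-colour-range {e} inc)) ,
    ≤-trans (proj₂ (a-colour-range {e} inc)) (<⇒≤ (<-by (4 + q') (lemma p' q')))
    where
    lemma : ∀ p' q' → (3 + q') * (3 + p') + suc (4 + q') ≡ 2 + (4 + p') * (3 + q')
    lemma = ℕ-Solver.solve-∀

  colour-bounds : ∀ e → 1 ≤ colour e × colour e ≤ 2 + p * q
  colour-bounds (inj₁ (ab i))   = a-colour-bounds {inj₁ (ab i)} (inj₁ refl)
  colour-bounds (inj₂ r)        = a-colour-bounds {inj₂ r} (inj₁ refl)
  colour-bounds (inj₁ (cd i j)) = ≤-trans (s≤s z≤n) (proj₁ (d-colour-range i j)) , m≤n⇒m≤1+n (proj₂ (d-colour-range i j))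
  colour-bounds (inj₁ (bc i j)) with cd-next-to-bc i j | d-colour-range i j
  ... | inj₁ cd≡bc+1 | 2≤cd , cd≤ = +-cancelʳ-≤ 1 1 _ (subst (2 ≤_) cd≡bc+1 2≤cd) ,
                                    ≤-trans (m≤m+n _ 1) (≤-trans (≤-reflexive (sym cd≡bc+1)) (m≤n⇒m≤1+n cd≤))
  ... | inj₂ bc≡1+cd | _   , cd≤ = subst (1 ≤_) (sym bc≡1+cd) (s≤s z≤n) , subst (_≤ 2 + p * q) (sym bc≡1+cd) (s≤s cd≤)

  interval-colouring : IntervalColoring G colour
  interval-colouring = (λ e → proj₁ (colour-bounds e)) , proper , interval-everywhere

  cyclic-colouring : CyclicIntervalColoring G (2 + p * q) colour
  cyclic-colouring = colour-bounds , proper , λ v → inj₁ (interval-everywhere v)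

  with-deficiency : (P : Graph → Set) → P G →
                    ∃ λ (att : Fin (p * q ∸ p ∸ 2 * q ∸ 2) → HV p q) → P (attach (Hertz p q) _ att)
  with-deficiency P PG = subst (λ m → ∃ λ (att : Fin m → HV p q) → P (attach (Hertz p q) m att))
                               (trans gaps≡deficiency (sym deficiency-≡)) ((λ _ → a) , PG)

theorem12 : (p q : ℕ) → 4 ≤ p → 3 ≤ q →
    IsCyclicDeficiency (Hertz p q) (p * q ∸ p ∸ 2 * q ∸ 2)
    × IsDeficiency (Hertz p q) (p * q ∸ p ∸ 2 * q ∸ 2)
theorem12 _ _ (s≤s (s≤s (s≤s (s≤s (z≤n {p'}))))) (s≤s (s≤s (s≤s (z≤n {q'})))) =
  ( with-deficiency HasCyclicIntervalColoring (2 + p * q , colour , cyclic-colouring)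
  , λ k k<def att colouring → <⇒≱ k<def (WithPendants.cyclic-deficiency≤pendants att colouring) )
  ,
  ( with-deficiency HasIntervalColoring (colour , interval-colouring)
  , λ k k<def att colouring → <⇒≱ k<def (WithPendants.deficiency≤pendants att colouring) )
  where open Construction p' q'
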